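{- Let $k\in\mathbb{N}$ and let $G_0$ be a fixed graph with $|V(G_0)|=k$ and $|E(G_0)|=k+1$. Then for all natural numbers $d<n$ (with $nd$ even), $$\mathbb{P}(\mathcal{S}_{n,d}\text{ contains a copy of }G_0)\leq (2d)^{k+1}/n.$$
   Context: $\mathcal{S}_{n,d}$ is the random $d$-regular multigraph on vertex set $[n]$ given by the configuration model: a uniformly random perfect matching of the set $[n]\times[d]$ into $nd/2$ pairs is chosen, and for each matched pair $\{(a,b),(a',b')\}$ an edge between $a$ and $a'$ is added (loops and multiple edges allowed). A copy of $G_0$ means a subgraph isomorphic to $G_0$. -}

module Defs where

open import Data.Nat using (ℕ; zero; suc; _*_; _<_)
open import Data.Bool using (Bool; true; false; T)
open import Data.Fin using (Fin; quotient; _<?_)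
open import Data.Fin.Properties using (_≟_; any?; all?)
open import Data.Vec using (Vec; []; _∷_; lookup)
open import Data.List using (List; [_]; concatMap; map; filter; length; allFin)
open import Data.List.Relation.Unary.Any using (Any)
import Data.List.Relation.Unary.Any as Any
open import Data.Product using (Σ; ∃; _×_; _,_)
open import Relation.Nullary using (¬_; Dec)
open import Relation.Nullary.Decidable using (_×-dec_; _→-dec_; ¬?; T?)
open import Relation.Binary.PropositionalEquality using (_≡_)

record Graph (k : ℕ) : Set where
  field
    adj   : Fin k → Fin k → Bool
    sym   : ∀ i j → adj i j ≡ adj j i
    irr   : ∀ i → adj i i ≡ false
open Graph public

edgePairs : {k : ℕ} → (G : Graph k) → List (Fin k × Fin k)
edgePairs {k} G =
  filter (λ { (i , j) → (i <? j) ×-dec (T? (adj G i j)) })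
         (concatMap (λ i → map (λ j → (i , j)) (allFin k)) (allFin k))

numEdges : {k : ℕ} → Graph k → ℕ
numEdges G = length (edgePairs G)

allVecs : (m r : ℕ) → List (Vec (Fin r) m)
allVecs zero    r = [ [] ]
allVecs (suc m) r = concatMap (λ i → map (i ∷_) (allVecs m r)) (allFin r)

-- Perfect matchings of a set of m points = fixed-point-free involutions on Fin m.
IsMatching : {m : ℕ} → Vec (Fin m) m → Set
IsMatching σ = ∀ p → (lookup σ (lookup σ p) ≡ p) × (¬ (lookup σ p ≡ p))

isMatching? : {m : ℕ} → (σ : Vec (Fin m) m) → Dec (IsMatching σ)
isMatching? σ = all? (λ p → (lookup σ (lookup σ p) ≟ p) ×-dec ¬? (lookup σ p ≟ p))

-- The points are [n] × [d], encoded as Fin (n * d) (point (a , b) ↦ a * d + b);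
-- the vertex of a point is its quotient by d.
vertexOf : (n d : ℕ) → Fin (n * d) → Fin n
vertexOf n d p = quotient {n} d p

Adjacent : {n : ℕ} (d : ℕ) → Vec (Fin (n * d)) (n * d) → Fin n → Fin n → Set
Adjacent {n} d σ a b = ∃ λ p → (vertexOf n d p ≡ a) × (vertexOf n d (lookup σ p) ≡ b)

adjacent? : {n : ℕ} (d : ℕ) (σ : Vec (Fin (n * d)) (n * d)) (a b : Fin n) → Dec (Adjacent d σ a b)
adjacent? {n} d σ a b = any? (λ p → (vertexOf n d p ≟ a) ×-dec (vertexOf n d (lookup σ p) ≟ b))

-- A copy of the simple graph G0 in S(σ): an injective vertex map φ : Fin k → Fin n
-- sending every edge of G0 to an edge of S(σ).  (Since G0 is simple and φ injective,
-- distinct edges of G0 go to distinct edges of S(σ).)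
IsCopy : {k n : ℕ} (d : ℕ) → Graph k → Vec (Fin (n * d)) (n * d) → Vec (Fin n) k → Set
IsCopy d G0 σ φ =
  (∀ i j → lookup φ i ≡ lookup φ j → i ≡ j) ×
  (∀ i j → T (adj G0 i j) → Adjacent d σ (lookup φ i) (lookup φ j))

isCopy? : {k n : ℕ} (d : ℕ) (G0 : Graph k) (σ : Vec (Fin (n * d)) (n * d)) (φ : Vec (Fin n) k) →
          Dec (IsCopy d G0 σ φ)
isCopy? {k} {n} d G0 σ φ =
  all? (λ i → all? (λ j → (lookup φ i ≟ lookup φ j) →-dec (i ≟ j))) ×-dec
  all? (λ i → all? (λ j → T? (adj G0 i j) →-dec adjacent? {n} d σ (lookup φ i) (lookup φ j)))

ContainsCopy : {k n : ℕ} (d : ℕ) → Graph k → Vec (Fin (n * d)) (n * d) → Set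
ContainsCopy {k} {n} d G0 σ = Any (IsCopy d G0 σ) (allVecs k n)

containsCopy? : {k n : ℕ} (d : ℕ) (G0 : Graph k) (σ : Vec (Fin (n * d)) (n * d)) → Dec (ContainsCopy d G0 σ)
containsCopy? {k} {n} d G0 σ = Any.any? (isCopy? d G0 σ) (allVecs k n)

-- All perfect matchings of [n] × [d] (the sample space of S_{n,d}, uniform measure).
matchings : (n d : ℕ) → List (Vec (Fin (n * d)) (n * d))
matchings n d = filter isMatching? (allVecs (n * d) (n * d))

numContaining : {k : ℕ} (n d : ℕ) → Graph k → ℕ
numContaining n d G0 = length (filter (containsCopy? {n = n} d G0) (matchings n d))

numMatchings : (n d : ℕ) → ℕ
numMatchings n d = length (matchings n d)

-- Put m = n d. Let L be a list of prescribed pairs of points and (x , y) a new pair. Conjugating by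
-- the transposition of y and a point y′ unused by x ∷ L shows that (x , y′) ∷ L has at least as many
-- extending matchings as (x , y) ∷ L. As the events σ x = y′ are disjoint, the matchings extending
-- (x , y) ∷ L are at most a 1/(m − 2|L| − 1) fraction of those extending L, which is ≤ 2/m while
-- 4|L| + 2 ≤ m.
-- A copy of G0 is witnessed by an injection of its k vertices together with, for each of its
-- ℓ = k + 1 edges, the two matched points realising it. A union bound over the n^k d^(2ℓ) witnesses
-- bounds the probability by n^k d^(2ℓ) (2/m)^ℓ = (2d)^ℓ / n as long as 4ℓ ≤ m + 2. Otherwise the
-- bound is trivial: n ≤ m < 4ℓ ≤ 2^ℓ, since k ≥ 3 (on at most two vertices there is at most one edge).
module Submission where

open import Defs hiding (sym)
open import Data.Nat using (ℕ; zero; suc; _+_; _*_; _∸_; _^_; _≤_; _<_; _≤?_; z≤n; s≤s; NonZero)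
open import Data.Nat.Divisibility using (_∣_)
open import Data.Nat.Properties
  using (≤-refl; ≤-trans; ≤-reflexive; ≰⇒>; n≤1+n; m≤m*n; +-mono-≤; +-monoˡ-≤; *-mono-≤; *-monoʳ-≤; *-monoˡ-≤;
         ^-monoˡ-≤; *-comm; *-assoc; *-suc; *-identityʳ; *-identityˡ; *-zeroʳ; +-identityʳ; *-distribʳ-+;
         +-cancelˡ-≤; *-cancelˡ-≤; m*n≢0; m^n≢0; m≤n⇒∃[o]m+o≡n; m≤n+o⇒m∸n≤o; m+n≤o⇒m≤o∸n; m+n≤o⇒m≤o;
         m+n≤o⇒n≤o; m+[n∸m]≡n; module ≤-Reasoning)
open import Data.Nat.Solver using (module +-*-Solver)
open import Data.Nat.ListAction using (sum)
open import Data.Bool using (T)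
open import Data.Fin using (Fin; combine; remainder) renaming (_<_ to _<ᶠ_; _<?_ to _<ᶠ?_)
open import Data.Fin.Properties using (_≟_; all?; ¬Fin0; remQuot-combine; combine-remQuot) renaming (<-asym to <ᶠ-asym)
open import Data.Fin.Permutation using (Permutation′; _⟨$⟩ʳ_; _⟨$⟩ˡ_; inverseˡ; inverseʳ; transpose)
open import Data.Vec using (Vec; []; _∷_; lookup; tabulate)
import Data.Vec.Properties as Vec
open import Data.List using (List; []; _∷_; _++_; length; filter; map; concatMap; cartesianProductWith; cartesianProduct; allFin)
open import Data.List.Properties using (length-map; length-++; length-tabulate; length-filter; filter-all; filter-none)
open import Data.List.Membership.Propositional using (_∈_; _∉_; lose)
open import Data.List.Membership.Propositional.Properties
  using (∈-filter⁺; ∈-filter⁻; ∈-map⁻; ∈-concatMap⁺; ∈-concatMap⁻; ∈-cartesianProductWith⁺; ∈-cartesianProduct⁺;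
         ∈-cartesianProduct⁻; ∈-allFin; ∈-++⁺ˡ; ∈-++⁺ʳ)
open import Data.List.Relation.Binary.Subset.Propositional using (_⊆_)
open import Data.List.Relation.Binary.Disjoint.Propositional using (Disjoint)
open import Data.List.Relation.Unary.Any as Any using (Any; here; there)
open import Data.List.Relation.Unary.All as All using (All; []; _∷_)
open import Data.List.Relation.Unary.AllPairs as AllPairs using (AllPairs; []; _∷_)
import Data.List.Relation.Unary.AllPairs.Properties as AllPairs
open import Data.List.Relation.Unary.Unique.Propositional using (Unique)
import Data.List.Relation.Unary.Unique.Propositional.Properties as Unique
open import Data.Product using (∃; _×_; _,_; proj₁; proj₂)
import Data.Product.Properties as ×
open import Data.Sum using (_⊎_; inj₁; inj₂)
open import Data.Empty using (⊥-elim)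
open import Function using (_∘_)
open import Relation.Nullary using (¬_; Dec; yes; no; contradiction)
open import Relation.Nullary.Decidable using (¬?; _×-dec_; _→-dec_; dec-true; dec-false)
open import Relation.Unary using (Decidable)
open import Relation.Binary.Definitions using (DecidableEquality)
open import Relation.Binary.PropositionalEquality
  using (_≡_; refl; sym; trans; cong; cong₂; subst; module ≡-Reasoning)

-- Counting with duplicate-free lists

length-concatMap : ∀ {A B : Set} (f : A → List B) xs → length (concatMap f xs) ≡ sum (map (length ∘ f) xs)
length-concatMap f []       = refl
length-concatMap f (x ∷ xs) = trans (length-++ (f x)) (cong (length (f x) +_) (length-concatMap f xs))

concatMap-map≡cartesianProductWith : ∀ {A B C : Set} (f : A → B → C) xs ys →
  concatMap (λ x → map (f x) ys) xs ≡ cartesianProductWith f xs ys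
concatMap-map≡cartesianProductWith f []       ys = refl
concatMap-map≡cartesianProductWith f (x ∷ xs) ys = cong (map (f x) ys ++_) (concatMap-map≡cartesianProductWith f xs ys)

length-cartesianProductWith : ∀ {A B C : Set} (f : A → B → C) xs ys →
  length (cartesianProductWith f xs ys) ≡ length xs * length ys
length-cartesianProductWith f []       ys = refl
length-cartesianProductWith f (x ∷ xs) ys =
  trans (length-++ (map (f x) ys)) (cong₂ _+_ (length-map (f x) ys) (length-cartesianProductWith f xs ys))

module _ {B : Set} where

  length*≤sum-map : ∀ (W : List B) {f : B → ℕ} {c} → (∀ {w} → w ∈ W → c ≤ f w) →
    length W * c ≤ sum (map f W)
  length*≤sum-map []      h = z≤n
  length*≤sum-map (w ∷ W) h = +-mono-≤ (h (here refl)) (length*≤sum-map W (h ∘ there))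

  sum-map*≤length* : ∀ (W : List B) {f : B → ℕ} {c b} → (∀ {w} → w ∈ W → f w * c ≤ b) →
    sum (map f W) * c ≤ length W * b
  sum-map*≤length* []      h = z≤n
  sum-map*≤length* (w ∷ W) {f} {c} h = ≤-trans (≤-reflexive (*-distribʳ-+ c (f w) _))
    (+-mono-≤ (h (here refl)) (sum-map*≤length* W (h ∘ there)))

module _ {A : Set} (_≟_ : DecidableEquality A) where

  Unique⇒length-≤ : ∀ {xs ys : List A} → Unique xs → xs ⊆ ys → length xs ≤ length ys
  Unique⇒length-≤ {[]}     _ _ = z≤n
  Unique⇒length-≤ {_ ∷ _} {[]} _ xs⊆[] with () ← xs⊆[] (here refl)
  Unique⇒length-≤ {xs} {y ∷ ys} xs! xs⊆ =
    ≤-trans (length-≤-suc-without y xs!) (s≤s (Unique⇒length-≤ (Unique.filter⁺ (≢? y) {xs} xs!) without⊆ys))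
    where
    ≢? : (y : A) → Decidable (λ x → ¬ x ≡ y)
    ≢? y x = ¬? (x ≟ y)

    length-≤-suc-without : ∀ y {xs} → Unique xs → length xs ≤ suc (length (filter (≢? y) xs))
    length-≤-suc-without y {[]}     _ = z≤n
    length-≤-suc-without y {x ∷ xs} (x∉xs ∷ xs!) with x ≟ y
    ... | yes refl =
      s≤s (≤-reflexive (sym (cong length (filter-all (≢? y) (All.map (λ x≢z → x≢z ∘ sym) x∉xs)))))
    ... | no _     = s≤s (length-≤-suc-without y xs!)

    without⊆ys : filter (≢? y) xs ⊆ ys
    without⊆ys z∈ with z∈xs , z≢y ← ∈-filter⁻ (≢? y) z∈ with xs⊆ z∈xs
    ... | here z≡y = ⊥-elim (z≢y z≡y)
    ... | there z∈ys = z∈ys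

  module _ {P : A → Set} (P? : Decidable P) where

    length-filter-≤-injection : ∀ {C : Set} {R : C → Set} (R? : Decidable R) (f : C → A) →
      (∀ {u v} → f u ≡ f v → u ≡ v) → ∀ {zs ys} → Unique zs →
      (∀ {z} → z ∈ zs → R z → f z ∈ ys × P (f z)) → length (filter R? zs) ≤ length (filter P? ys)
    length-filter-≤-injection R? f f-inj {zs} {ys} zs! h = ≤-trans (≤-reflexive (sym (length-map f (filter R? zs))))
      (Unique⇒length-≤ (Unique.map⁺ f-inj (Unique.filter⁺ R? {zs} zs!)) image⊆)
      where
      image⊆ : map f (filter R? zs) ⊆ filter P? ys
      image⊆ v∈ with z , z∈ , refl ← ∈-map⁻ f v∈ with z∈zs , Rz ← ∈-filter⁻ R? z∈ =
        ∈-filter⁺ P? (proj₁ (h z∈zs Rz)) (proj₂ (h z∈zs Rz))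

    module _ {B : Set} {Q : B → A → Set} (Q? : ∀ w → Decidable (Q w)) {xs : List A} (xs! : Unique xs) where

      length-filter-≤-sum : ∀ W → (∀ {x} → x ∈ xs → P x → Any (λ w → Q w x) W) →
        length (filter P? xs) ≤ sum (map (λ w → length (filter (Q? w) xs)) W)
      length-filter-≤-sum W cover = ≤-trans (Unique⇒length-≤ (Unique.filter⁺ P? {xs} xs!) ⊆union)
        (≤-reflexive (length-concatMap (λ w → filter (Q? w) xs) W))
        where
        ⊆union : filter P? xs ⊆ concatMap (λ w → filter (Q? w) xs) W
        ⊆union x∈ with x∈xs , Px ← ∈-filter⁻ P? x∈ =
          ∈-concatMap⁺ (λ w → filter (Q? w) xs) (Any.map (∈-filter⁺ (Q? _) x∈xs) (cover x∈xs Px))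

      sum-≤-length-filter : ∀ {W} → Unique W → (g : A → B) → (∀ {w x} → Q w x → g x ≡ w × P x) →
        sum (map (λ w → length (filter (Q? w) xs)) W) ≤ length (filter P? xs)
      sum-≤-length-filter {W} W! g fibre = ≤-trans (≤-reflexive (sym (length-concatMap fibreOf W)))
        (Unique⇒length-≤ union! union⊆)
        where
        fibreOf : B → List A
        fibreOf w = filter (Q? w) xs

        disjoint : ∀ {w w′} → ¬ w ≡ w′ → Disjoint (fibreOf w) (fibreOf w′)
        disjoint w≢w′ (x∈w , x∈w′) =
          w≢w′ (trans (sym (proj₁ (fibre (proj₂ (∈-filter⁻ (Q? _) {xs = xs} x∈w)))))
                      (proj₁ (fibre (proj₂ (∈-filter⁻ (Q? _) {xs = xs} x∈w′)))))

        union! : Unique (concatMap fibreOf W)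
        union! = Unique.concat⁺ (All.tabulate fibre!) (AllPairs.map⁺ (AllPairs.map disjoint W!))
          where
          fibre! : ∀ {ys} → ys ∈ map fibreOf W → Unique ys
          fibre! ys∈ with w , _ , refl ← ∈-map⁻ fibreOf ys∈ = Unique.filter⁺ (Q? w) {xs} xs!

        union⊆ : concatMap fibreOf W ⊆ filter P? xs
        union⊆ x∈ with w , x∈w ← Any.satisfied (∈-concatMap⁻ fibreOf {xs = W} x∈)
                  with x∈xs , Qwx ← ∈-filter⁻ (Q? w) {xs = xs} x∈w = ∈-filter⁺ P? x∈xs (proj₂ (fibre Qwx))

allVecs-suc : ∀ m r → allVecs (suc m) r ≡ cartesianProductWith _∷_ (allFin r) (allVecs m r)
allVecs-suc m r = concatMap-map≡cartesianProductWith _∷_ (allFin r) (allVecs m r)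

allVecs! : ∀ m r → Unique (allVecs m r)
allVecs! zero    r = [] ∷ []
allVecs! (suc m) r rewrite allVecs-suc m r =
  Unique.cartesianProductWith⁺ _∷_ Vec.∷-injective (Unique.allFin⁺ r) (allVecs! m r)

∈-allVecs : ∀ {m r} (v : Vec (Fin r) m) → v ∈ allVecs m r
∈-allVecs {zero}      []      = here refl
∈-allVecs {suc m} {r} (i ∷ v) rewrite allVecs-suc m r = ∈-cartesianProductWith⁺ _∷_ (∈-allFin i) (∈-allVecs v)

length-allVecs : ∀ m r → length (allVecs m r) ≡ r ^ m
length-allVecs zero    r = refl
length-allVecs (suc m) r rewrite allVecs-suc m r =
  trans (length-cartesianProductWith _∷_ (allFin r) (allVecs m r))
        (cong₂ _*_ (length-tabulate {n = r} (λ i → i)) (length-allVecs m r))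

module _ {n : ℕ} where

  transpose-matchˡ : ∀ (i j : Fin n) → transpose i j ⟨$⟩ʳ i ≡ j
  transpose-matchˡ i j rewrite dec-true (i ≟ i) refl = refl

  transpose-fixes : ∀ {i j k : Fin n} → ¬ k ≡ i → ¬ k ≡ j → transpose i j ⟨$⟩ʳ k ≡ k
  transpose-fixes {i} {j} {k} k≢i k≢j rewrite dec-false (k ≟ i) k≢i | dec-false (k ≟ j) k≢j = refl

m≤2*[m∸1+2j] : ∀ {j m} → 4 * suc j ≤ 2 + m → m ≤ 2 * (m ∸ suc (2 * j))
m≤2*[m∸1+2j] {j} {m} 4[1+j]≤2+m = begin
  m                   ≡⟨ sym (m+[n∸m]≡n (m+n≤o⇒m≤o u 2u≤m)) ⟩
  u + (m ∸ u)         ≤⟨ +-monoˡ-≤ (m ∸ u) (m+n≤o⇒m≤o∸n u 2u≤m) ⟩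
  (m ∸ u) + (m ∸ u)   ≡⟨ cong ((m ∸ u) +_) (sym (+-identityʳ (m ∸ u))) ⟩
  2 * (m ∸ u)         ∎
  where
  open ≤-Reasoning
  open +-*-Solver
  u = suc (2 * j)
  2u≤m : u + u ≤ m
  2u≤m = +-cancelˡ-≤ 2 (u + u) m (subst (_≤ 2 + m)
    (solve 1 (λ j → con 4 :* (con 1 :+ j) := con 2 :+ ((con 1 :+ con 2 :* j) :+ (con 1 :+ con 2 :* j))) refl j) 4[1+j]≤2+m)

module _ {A : Set} where

  SameEdge : A × A → A × A → Set
  SameEdge (x , y) (a , b) = (x ≡ a × y ≡ b) ⊎ (x ≡ b × y ≡ a)

  DistinctEdges : List (A × A) → Set
  DistinctEdges = AllPairs (λ e e′ → ¬ SameEdge e e′)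

  ends : A × A → List A
  ends (a , b) = a ∷ b ∷ []

  points : List (A × A) → List A
  points = concatMap ends

  length-points : ∀ L → length (points L) ≡ 2 * length L
  length-points []      = refl
  length-points (_ ∷ L) = trans (cong (2 +_) (length-points L)) (sym (*-suc 2 (length L)))

-- Matchings extending prescribed pairs

module Matchings (m : ℕ) where

  open import Data.List.Membership.DecPropositional (_≟_ {m}) using (_∈?_)

  Pair : Set
  Pair = Fin m × Fin m

  Matches : Vec (Fin m) m → Pair → Set
  Matches σ (a , b) = lookup σ a ≡ b

  Extends : List Pair → Vec (Fin m) m → Set
  Extends L σ = All (Matches σ) L

  extends? : ∀ L → Decidable (Extends L)
  extends? L σ = All.all? (λ { (a , b) → lookup σ a ≟ b }) L

  allMatchings : List (Vec (Fin m) m)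
  allMatchings = filter isMatching? (allVecs m m)

  allMatchings! : Unique allMatchings
  allMatchings! = Unique.filter⁺ isMatching? {allVecs m m} (allVecs! m m)

  ∈-allMatchings⁺ : ∀ {σ} → IsMatching σ → σ ∈ allMatchings
  ∈-allMatchings⁺ {σ} = ∈-filter⁺ isMatching? (∈-allVecs σ)

  ∈-allMatchings⁻ : ∀ {σ} → σ ∈ allMatchings → IsMatching σ
  ∈-allMatchings⁻ σ∈ = proj₂ (∈-filter⁻ isMatching? {xs = allVecs m m} σ∈)

  numExtending : List Pair → ℕ
  numExtending L = length (filter (extends? L) allMatchings)

  Matches-sym : ∀ {σ x y} → IsMatching σ → Matches σ (x , y) → Matches σ (y , x)
  Matches-sym {σ} {x} σ-matching σx≡y = trans (cong (lookup σ) (sym σx≡y)) (proj₁ (σ-matching x))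

  Matches-∈-ends⇒SameEdge : ∀ {x y a b} σ → IsMatching σ → Matches σ (x , y) → Matches σ (a , b) →
    y ∈ ends (a , b) → SameEdge (x , y) (a , b)
  Matches-∈-ends⇒SameEdge σ σ-matching σx σa (here y≡a) =
    inj₂ (trans (sym (Matches-sym {σ} σ-matching σx)) (trans (cong (lookup σ) y≡a) σa) , y≡a)
  Matches-∈-ends⇒SameEdge σ σ-matching σx σa (there (here y≡b)) =
    inj₁ (trans (sym (Matches-sym {σ} σ-matching σx))
                (trans (cong (lookup σ) y≡b) (Matches-sym {σ} σ-matching σa)) , y≡b)

  Fresh : Fin m → Fin m → List Pair → Set
  Fresh x y L = ¬ x ≡ y × y ∉ points L

  fresh? : ∀ x y L → Dec (Fresh x y L)
  fresh? x y L = ¬? (x ≟ y) ×-dec ¬? (y ∈? points L)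

  extends-∷⇒Fresh : ∀ {x y L} σ → IsMatching σ → All (¬_ ∘ SameEdge (x , y)) L →
    Extends ((x , y) ∷ L) σ → Fresh x y L
  extends-∷⇒Fresh {x} {y} {L} σ σ-matching new (σx ∷ σL) = x≢y , y∉L
    where
    x≢y : ¬ x ≡ y
    x≢y x≡y = proj₂ (σ-matching x) (trans σx (sym x≡y))

    y∉L : y ∉ points L
    y∉L y∈L = All.lookupWith
      (λ { (σe , e≁xy) y∈e → e≁xy (Matches-∈-ends⇒SameEdge σ σ-matching σx σe y∈e) })
      (All.zip (σL , new)) (∈-concatMap⁻ ends {xs = L} y∈L)

  numExtending-∷-≡0 : ∀ {x y L} → All (¬_ ∘ SameEdge (x , y)) L → ¬ Fresh x y L →
    numExtending ((x , y) ∷ L) ≡ 0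
  numExtending-∷-≡0 {x} {y} {L} new stale = cong length (filter-none (extends? ((x , y) ∷ L))
    (All.tabulate (λ {σ} σ∈ σ-extends → stale (extends-∷⇒Fresh σ (∈-allMatchings⁻ σ∈) new σ-extends))))

  relabel : Permutation′ m → Vec (Fin m) m → Vec (Fin m) m
  relabel π σ = tabulate (λ p → π ⟨$⟩ʳ lookup σ (π ⟨$⟩ˡ p))

  module _ (π : Permutation′ m) where

    private
      π-injective : ∀ {p q} → π ⟨$⟩ʳ p ≡ π ⟨$⟩ʳ q → p ≡ q
      π-injective {p} {q} eq = trans (sym (inverseˡ π)) (trans (cong (π ⟨$⟩ˡ_) eq) (inverseˡ π))

    lookup-relabel : ∀ σ p → lookup (relabel π σ) (π ⟨$⟩ʳ p) ≡ π ⟨$⟩ʳ lookup σ p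
    lookup-relabel σ p =
      trans (Vec.lookup∘tabulate _ (π ⟨$⟩ʳ p)) (cong (λ q → π ⟨$⟩ʳ lookup σ q) (inverseˡ π))

    relabel-injective : ∀ {σ τ} → relabel π σ ≡ relabel π τ → σ ≡ τ
    relabel-injective {σ} {τ} eq = trans (sym (Vec.tabulate∘lookup σ))
      (trans (Vec.tabulate-cong pointwise) (Vec.tabulate∘lookup τ))
      where
      pointwise : ∀ p → lookup σ p ≡ lookup τ p
      pointwise p = π-injective (trans (sym (lookup-relabel σ p))
                                 (trans (cong (λ ρ → lookup ρ (π ⟨$⟩ʳ p)) eq) (lookup-relabel τ p)))

    relabel-isMatching : ∀ {σ} → IsMatching σ → IsMatching (relabel π σ)
    relabel-isMatching {σ} σ-matching p = subst (λ q → IsMatching-at q) (inverseʳ π) (at-image (π ⟨$⟩ˡ p))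
      where
      IsMatching-at : Fin m → Set
      IsMatching-at p = (lookup (relabel π σ) (lookup (relabel π σ) p) ≡ p) × ¬ (lookup (relabel π σ) p ≡ p)

      at-image : ∀ q → IsMatching-at (π ⟨$⟩ʳ q)
      at-image q =
        trans (cong (lookup (relabel π σ)) (lookup-relabel σ q))
              (trans (lookup-relabel σ (lookup σ q)) (cong (π ⟨$⟩ʳ_) (proj₁ (σ-matching q)))) ,
        λ fixed → proj₂ (σ-matching q) (π-injective (trans (sym (lookup-relabel σ q)) fixed))

    relabel-extends : ∀ σ L → All (λ z → π ⟨$⟩ʳ z ≡ z) (points L) → Extends L σ → Extends L (relabel π σ)
    relabel-extends σ []            _                      _          = []
    relabel-extends σ ((a , b) ∷ L) (πa≡a ∷ πb≡b ∷ fixes) (σa≡b ∷ σL) =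
      σ′a≡b ∷ relabel-extends σ L fixes σL
      where
      open ≡-Reasoning
      σ′a≡b : lookup (relabel π σ) a ≡ b
      σ′a≡b = begin
        lookup (relabel π σ) a             ≡⟨ cong (lookup (relabel π σ)) (sym πa≡a) ⟩
        lookup (relabel π σ) (π ⟨$⟩ʳ a)    ≡⟨ lookup-relabel σ a ⟩
        π ⟨$⟩ʳ lookup σ a                   ≡⟨ cong (π ⟨$⟩ʳ_) σa≡b ⟩
        π ⟨$⟩ʳ b                            ≡⟨ πb≡b ⟩
        b                                   ∎

  numExtending-≤-swap : ∀ {x y y′ L} → ¬ x ≡ y → ¬ x ≡ y′ → y ∉ points L → y′ ∉ points L →
    numExtending ((x , y) ∷ L) ≤ numExtending ((x , y′) ∷ L)
  numExtending-≤-swap {x} {y} {y′} {L} x≢y x≢y′ y∉L y′∉L =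
    length-filter-≤-injection (Vec.≡-dec _≟_) (extends? ((x , y′) ∷ L)) (extends? ((x , y) ∷ L))
      (relabel π) (relabel-injective π) allMatchings! image
    where
    π = transpose y y′

    fixes : All (λ z → π ⟨$⟩ʳ z ≡ z) (points L)
    fixes = All.tabulate (λ z∈ → transpose-fixes (λ { refl → y∉L z∈ }) (λ { refl → y′∉L z∈ }))

    image : ∀ {σ} → σ ∈ allMatchings → Extends ((x , y) ∷ L) σ →
      relabel π σ ∈ allMatchings × Extends ((x , y′) ∷ L) (relabel π σ)
    image {σ} σ∈ (σx≡y ∷ σL) =
      ∈-allMatchings⁺ (relabel-isMatching π {σ} (∈-allMatchings⁻ σ∈)) ,
      σ′x≡y′ ∷ relabel-extends π σ L fixes σL
      where
      open ≡-Reasoning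
      σ′x≡y′ : lookup (relabel π σ) x ≡ y′
      σ′x≡y′ = begin
        lookup (relabel π σ) x             ≡⟨ cong (lookup (relabel π σ)) (sym (transpose-fixes x≢y x≢y′)) ⟩
        lookup (relabel π σ) (π ⟨$⟩ʳ x)    ≡⟨ lookup-relabel π σ x ⟩
        π ⟨$⟩ʳ lookup σ x                   ≡⟨ cong (π ⟨$⟩ʳ_) σx≡y ⟩
        π ⟨$⟩ʳ y                            ≡⟨ transpose-matchˡ y y′ ⟩
        y′                                  ∎

  numExtending-∷-fresh : ∀ {x y L} → Fresh x y L →
    numExtending ((x , y) ∷ L) * (m ∸ suc (2 * length L)) ≤ numExtending L
  numExtending-∷-fresh {x} {y} {L} (x≢y , y∉L) = begin
    C * (m ∸ suc (2 * length L))                        ≤⟨ *-monoʳ-≤ C enough-targets ⟩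
    C * length Y                                        ≡⟨ *-comm C (length Y) ⟩
    length Y * C                                        ≤⟨ length*≤sum-map Y swap ⟩
    sum (map (λ y′ → numExtending ((x , y′) ∷ L)) Y)    ≤⟨ by-target ⟩
    numExtending L                                      ∎
    where
    open ≤-Reasoning
    C = numExtending ((x , y) ∷ L)
    Z = x ∷ points L

    Y : List (Fin m)
    Y = filter (λ z → ¬? (z ∈? Z)) (allFin m)

    ∉Z : ∀ {y′} → y′ ∈ Y → y′ ∉ Z
    ∉Z y′∈ = proj₂ (∈-filter⁻ (λ z → ¬? (z ∈? Z)) {xs = allFin m} y′∈)

    allFin⊆Z++Y : allFin m ⊆ Z ++ Y
    allFin⊆Z++Y {z} z∈ with z ∈? Z
    ... | yes z∈Z = ∈-++⁺ˡ z∈Z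
    ... | no  z∉Z = ∈-++⁺ʳ Z (∈-filter⁺ (λ z → ¬? (z ∈? Z)) z∈ z∉Z)

    enough-targets : m ∸ suc (2 * length L) ≤ length Y
    enough-targets = m≤n+o⇒m∸n≤o m (suc (2 * length L)) (begin
      m                     ≡⟨ sym (length-tabulate {n = m} (λ i → i)) ⟩
      length (allFin m)     ≤⟨ Unique⇒length-≤ _≟_ (Unique.allFin⁺ m) allFin⊆Z++Y ⟩
      length (Z ++ Y)       ≡⟨ length-++ Z ⟩
      length Z + length Y   ≡⟨ cong (λ l → suc l + length Y) (length-points L) ⟩
      suc (2 * length L) + length Y ∎)

    swap : ∀ {y′} → y′ ∈ Y → C ≤ numExtending ((x , y′) ∷ L)
    swap y′∈ = numExtending-≤-swap x≢y (λ x≡y′ → ∉Z y′∈ (here (sym x≡y′))) y∉L (∉Z y′∈ ∘ there)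

    by-target : sum (map (λ y′ → numExtending ((x , y′) ∷ L)) Y) ≤ numExtending L
    by-target = sum-≤-length-filter (Vec.≡-dec _≟_) (extends? L) (λ y′ → extends? ((x , y′) ∷ L)) allMatchings!
      (Unique.filter⁺ (λ z → ¬? (z ∈? Z)) {allFin m} (Unique.allFin⁺ m)) (λ σ → lookup σ x)
      (λ { (σx ∷ σL) → σx , σL })

  numExtending-∷ : ∀ {x y L} → All (¬_ ∘ SameEdge (x , y)) L →
    numExtending ((x , y) ∷ L) * (m ∸ suc (2 * length L)) ≤ numExtending L
  numExtending-∷ {x} {y} {L} new with fresh? x y L
  ... | yes fresh = numExtending-∷-fresh fresh
  ... | no stale rewrite numExtending-∷-≡0 new stale = z≤n

  numExtending-bound : ∀ L → DistinctEdges L → 4 * length L ≤ 2 + m →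
    numExtending L * m ^ length L ≤ 2 ^ length L * length allMatchings
  numExtending-bound [] [] _ = ≤-reflexive (begin-equality
    numExtending [] * 1        ≡⟨ *-identityʳ _ ⟩
    numExtending []            ≡⟨ cong length (filter-all (extends? []) {allMatchings} (All.tabulate (λ _ → []))) ⟩
    length allMatchings        ≡⟨ sym (*-identityˡ _) ⟩
    1 * length allMatchings    ∎)
    where open ≤-Reasoning
  numExtending-bound ((x , y) ∷ L) (new ∷ distinct) 4ℓ≤2+m = begin
    C * (m * m ^ j)           ≤⟨ *-monoʳ-≤ C (*-monoˡ-≤ (m ^ j) (m≤2*[m∸1+2j] 4ℓ≤2+m)) ⟩
    C * (2 * u * m ^ j)       ≡⟨ solve 3 (λ c u p → c :* (con 2 :* u :* p) := con 2 :* (c :* u :* p)) refl C u (m ^ j) ⟩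
    2 * (C * u * m ^ j)       ≤⟨ *-monoʳ-≤ 2 (*-monoˡ-≤ (m ^ j) (numExtending-∷ new)) ⟩
    2 * (C′ * m ^ j)          ≤⟨ *-monoʳ-≤ 2 (numExtending-bound L distinct 4j≤2+m) ⟩
    2 * (2 ^ j * A)           ≡⟨ sym (*-assoc 2 (2 ^ j) A) ⟩
    2 ^ suc j * A             ∎
    where
    open ≤-Reasoning
    open +-*-Solver
    j = length L
    u = m ∸ suc (2 * j)
    C = numExtending ((x , y) ∷ L)
    C′ = numExtending L
    A = length allMatchings
    4j≤2+m : 4 * j ≤ 2 + m
    4j≤2+m = ≤-trans (*-monoʳ-≤ 4 (n≤1+n j)) 4ℓ≤2+m

-- Copies of G0 and their witnesses

module _ {A : Set} {_<_ : A → A → Set} (<-asym : ∀ {a b} → a < b → ¬ b < a) where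

  ordered⇒DistinctEdges : ∀ {E : List (A × A)} → Unique E → All (λ e → proj₁ e < proj₂ e) E → DistinctEdges E
  ordered⇒DistinctEdges {[]}    []         []             = []
  ordered⇒DistinctEdges {e ∷ E} (e∉E ∷ E!) (i<j ∷ E-ordered) =
    All.zipWith distinct (e∉E , E-ordered) ∷ ordered⇒DistinctEdges E! E-ordered
    where
    distinct : ∀ {e′} → ¬ e ≡ e′ × proj₁ e′ < proj₂ e′ → ¬ SameEdge e e′
    distinct (e≢e′ , _)    (inj₁ (refl , refl)) = e≢e′ refl
    distinct (_    , j<i) (inj₂ (refl , refl)) = <-asym i<j j<i

module _ {k n : ℕ} where

  IsInjection : Vec (Fin n) k → Set
  IsInjection φ = ∀ i j → lookup φ i ≡ lookup φ j → i ≡ j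

  isInjection? : ∀ φ → Dec (IsInjection φ)
  isInjection? φ = all? (λ i → all? (λ j → (lookup φ i ≟ lookup φ j) →-dec (i ≟ j)))

vertexOf-combine : ∀ {n} d (u : Fin n) (a : Fin d) → vertexOf n d (combine u a) ≡ u
vertexOf-combine d u a = cong proj₁ (remQuot-combine u a)

module _ {k n d : ℕ} where

  open Matchings (n * d)

  pointPairs : (E : List (Fin k × Fin k)) → Vec (Fin n) k → (as bs : Vec (Fin d) (length E)) → List Pair
  pointPairs []            φ []       []       = []
  pointPairs ((i , j) ∷ E) φ (a ∷ as) (b ∷ bs) =
    (combine (lookup φ i) a , combine (lookup φ j) b) ∷ pointPairs E φ as bs

  length-pointPairs : ∀ E φ as bs → length (pointPairs E φ as bs) ≡ length E
  length-pointPairs []            φ []       []       = refl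
  length-pointPairs ((i , j) ∷ E) φ (a ∷ as) (b ∷ bs) = cong suc (length-pointPairs E φ as bs)

  ∈-pointPairs⁻ : ∀ E φ as bs {x y} → (x , y) ∈ pointPairs E φ as bs →
    Any (λ e → vertexOf n d x ≡ lookup φ (proj₁ e) × vertexOf n d y ≡ lookup φ (proj₂ e)) E
  ∈-pointPairs⁻ []            φ []       []       ()
  ∈-pointPairs⁻ ((i , j) ∷ E) φ (a ∷ as) (b ∷ bs) (here refl) = here (vertexOf-combine d _ a , vertexOf-combine d _ b)
  ∈-pointPairs⁻ ((i , j) ∷ E) φ (a ∷ as) (b ∷ bs) (there p)   = there (∈-pointPairs⁻ E φ as bs p)

  pointPairs-distinct : ∀ {φ} → IsInjection φ →
    ∀ E as bs → DistinctEdges E → DistinctEdges (pointPairs E φ as bs)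
  pointPairs-distinct φ-inj []            []       []       []             = []
  pointPairs-distinct {φ} φ-inj ((i , j) ∷ E) (a ∷ as) (b ∷ bs) (ij≁E ∷ E-distinct) =
    All.tabulate head≁ ∷ pointPairs-distinct φ-inj E as bs E-distinct
    where
    x = combine (lookup φ i) a
    y = combine (lookup φ j) b

    reflect : ∀ {x′ y′} (e′ : Fin k × Fin k) →
      vertexOf n d x′ ≡ lookup φ (proj₁ e′) → vertexOf n d y′ ≡ lookup φ (proj₂ e′) →
      SameEdge (x , y) (x′ , y′) → SameEdge (i , j) e′
    reflect e′ vx′ vy′ (inj₁ (refl , refl)) =
      inj₁ (φ-inj _ _ (trans (sym (vertexOf-combine d _ a)) vx′) , φ-inj _ _ (trans (sym (vertexOf-combine d _ b)) vy′))
    reflect e′ vx′ vy′ (inj₂ (refl , refl)) =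
      inj₂ (φ-inj _ _ (trans (sym (vertexOf-combine d _ a)) vy′) , φ-inj _ _ (trans (sym (vertexOf-combine d _ b)) vx′))

    head≁ : ∀ {e} → e ∈ pointPairs E φ as bs → ¬ SameEdge (x , y) e
    head≁ {x′ , y′} e∈ same =
      All.lookupWith (λ {e′} ij≁e′ (vx′ , vy′) → ij≁e′ (reflect e′ vx′ vy′ same)) ij≁E (∈-pointPairs⁻ E φ as bs e∈)

  copy⇒extends : ∀ {σ φ} E → (∀ {i j} → (i , j) ∈ E → Adjacent d σ (lookup φ i) (lookup φ j)) →
    ∃ λ as → ∃ λ bs → Extends (pointPairs E φ as bs) σ
  copy⇒extends []            adjacent = [] , [] , []
  copy⇒extends {σ} {φ} ((i , j) ∷ E) adjacent
    with p , p-vertex , σp-vertex ← adjacent (here refl)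
       | as , bs , σ-extends ← copy⇒extends {σ} {φ} E (adjacent ∘ there) =
    remainder {n} d p ∷ as , remainder {n} d (lookup σ p) ∷ bs , σ-matches ∷ σ-extends
    where
    σ-matches : lookup σ (combine (lookup φ i) (remainder {n} d p)) ≡ combine (lookup φ j) (remainder {n} d (lookup σ p))
    σ-matches rewrite sym p-vertex | sym σp-vertex | combine-remQuot {n} d p = sym (combine-remQuot {n} d (lookup σ p))

allPairs : ∀ k → List (Fin k × Fin k)
allPairs k = concatMap (λ i → map (λ j → (i , j)) (allFin k)) (allFin k)

allPairs! : ∀ k → Unique (allPairs k)
allPairs! k = subst Unique (sym (concatMap-map≡cartesianProductWith _,_ (allFin k) (allFin k)))
  (Unique.cartesianProduct⁺ (Unique.allFin⁺ k) (Unique.allFin⁺ k))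

orderedPairs : ∀ k → List (Fin k × Fin k)
orderedPairs k = filter (λ e → proj₁ e <ᶠ? proj₂ e) (allPairs k)

module _ {k : ℕ} (G0 : Graph k) where

  edgePairs! : Unique (edgePairs G0)
  edgePairs! = Unique.filter⁺ _ {allPairs k} (allPairs! k)

  ∈-edgePairs⁻ : ∀ {i j} → (i , j) ∈ edgePairs G0 → i <ᶠ j × T (adj G0 i j)
  ∈-edgePairs⁻ e∈ = proj₂ (∈-filter⁻ _ {xs = allPairs k} e∈)

  numEdges-≤ : numEdges G0 ≤ length (orderedPairs k)
  numEdges-≤ = Unique⇒length-≤ (×.≡-dec _≟_ _≟_) edgePairs! edges⊆ordered
    where
    edges⊆ordered : edgePairs G0 ⊆ orderedPairs k
    edges⊆ordered e∈ = ∈-filter⁺ _ (proj₁ (∈-filter⁻ _ {xs = allPairs k} e∈)) (proj₁ (∈-edgePairs⁻ e∈))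

  edgePairs-distinct : DistinctEdges (edgePairs G0)
  edgePairs-distinct = ordered⇒DistinctEdges <ᶠ-asym edgePairs! (All.tabulate (proj₁ ∘ ∈-edgePairs⁻))

module _ {k : ℕ} (G0 : Graph k) (n d : ℕ) where

  open Matchings (n * d)

  private
    ℓ = numEdges G0

  -- Besides the vertex map φ, a witness gives for each edge ij of G0 the positions, within the cells
  -- of φ i and φ j, of the two matched points realising it.
  Witness : Set
  Witness = Vec (Fin n) k × Vec (Fin d) ℓ × Vec (Fin d) ℓ

  witnesses : List Witness
  witnesses = cartesianProduct (filter isInjection? (allVecs k n)) (cartesianProduct (allVecs ℓ d) (allVecs ℓ d))

  witnessPairs : Witness → List Pair
  witnessPairs (φ , as , bs) = pointPairs (edgePairs G0) φ as bs

  length-witnesses : length witnesses ≤ n ^ k * (d ^ ℓ * d ^ ℓ)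
  length-witnesses = begin
    length witnesses
      ≡⟨ length-cartesianProductWith _,_ injections _ ⟩
    length injections * length (cartesianProduct (allVecs ℓ d) (allVecs ℓ d))
      ≡⟨ cong (length injections *_) (length-cartesianProductWith _,_ (allVecs ℓ d) (allVecs ℓ d)) ⟩
    length injections * (length (allVecs ℓ d) * length (allVecs ℓ d))
      ≤⟨ *-mono-≤ (length-filter isInjection? (allVecs k n))
                  (≤-reflexive (cong₂ _*_ (length-allVecs ℓ d) (length-allVecs ℓ d))) ⟩
    length (allVecs k n) * (d ^ ℓ * d ^ ℓ)
      ≡⟨ cong (_* (d ^ ℓ * d ^ ℓ)) (length-allVecs k n) ⟩
    n ^ k * (d ^ ℓ * d ^ ℓ) ∎
    where
    open ≤-Reasoning
    injections = filter isInjection? (allVecs k n)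

  numContaining-≤-sum : numContaining n d G0 ≤ sum (map (numExtending ∘ witnessPairs) witnesses)
  numContaining-≤-sum = length-filter-≤-sum (Vec.≡-dec _≟_) (containsCopy? d G0) (extends? ∘ witnessPairs)
    allMatchings! witnesses cover
    where
    cover : ∀ {σ} → σ ∈ allMatchings → ContainsCopy d G0 σ → Any (λ w → Extends (witnessPairs w) σ) witnesses
    cover {σ} _ copy
      with φ , φ-injection , adjacent ← Any.satisfied {P = IsCopy d G0 σ} copy
      with as , bs , σ-extends ← copy⇒extends {σ = σ} {φ} (edgePairs G0) (adjacent _ _ ∘ proj₂ ∘ ∈-edgePairs⁻ G0) =
      lose (∈-cartesianProduct⁺ (∈-filter⁺ isInjection? (∈-allVecs φ) φ-injection)
                                (∈-cartesianProduct⁺ (∈-allVecs as) (∈-allVecs bs)))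
           σ-extends

  numExtending-witness : 4 * ℓ ≤ 2 + n * d → ∀ {w} → w ∈ witnesses →
    numExtending (witnessPairs w) * (n * d) ^ ℓ ≤ 2 ^ ℓ * numMatchings n d
  numExtending-witness 4ℓ≤2+nd {w@(φ , as , bs)} w∈ =
    subst (λ l → numExtending (witnessPairs w) * (n * d) ^ l ≤ 2 ^ l * numMatchings n d) length≡ℓ
      (numExtending-bound (witnessPairs w) (pointPairs-distinct φ-injection (edgePairs G0) as bs (edgePairs-distinct G0))
        (subst (λ l → 4 * l ≤ 2 + n * d) (sym length≡ℓ) 4ℓ≤2+nd))
    where
    length≡ℓ = length-pointPairs (edgePairs G0) φ as bs
    φ-injection = proj₂ (∈-filter⁻ isInjection? {xs = allVecs k n} (proj₁ (∈-cartesianProduct⁻ _ _ w∈)))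

  numContaining-bound : ∀ {ℓ′} → numEdges G0 ≡ ℓ′ → 4 * ℓ′ ≤ 2 + n * d →
    numContaining n d G0 * (n * d) ^ ℓ′ ≤ n ^ k * (d ^ ℓ′ * d ^ ℓ′) * (2 ^ ℓ′ * numMatchings n d)
  numContaining-bound refl 4ℓ≤2+nd = begin
    numContaining n d G0 * (n * d) ^ ℓ
      ≤⟨ *-monoˡ-≤ _ numContaining-≤-sum ⟩
    sum (map (numExtending ∘ witnessPairs) witnesses) * (n * d) ^ ℓ
      ≤⟨ sum-map*≤length* witnesses (numExtending-witness 4ℓ≤2+nd) ⟩
    length witnesses * (2 ^ ℓ * numMatchings n d)
      ≤⟨ *-monoˡ-≤ _ length-witnesses ⟩
    n ^ k * (d ^ ℓ * d ^ ℓ) * (2 ^ ℓ * numMatchings n d) ∎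
    where open ≤-Reasoning

-- The two regimes of n d

numEdges≡1+k⇒3≤k : ∀ {k} (G0 : Graph k) → numEdges G0 ≡ suc k → 3 ≤ k
numEdges≡1+k⇒3≤k {0} G0 ℓ≡1 = contradiction (subst (_≤ 0) ℓ≡1 (numEdges-≤ G0)) λ ()
numEdges≡1+k⇒3≤k {1} G0 ℓ≡2 = contradiction (subst (_≤ 0) ℓ≡2 (numEdges-≤ G0)) λ ()
numEdges≡1+k⇒3≤k {2} G0 ℓ≡3 = contradiction (subst (_≤ 1) ℓ≡3 (numEdges-≤ G0)) λ { (s≤s ()) }
numEdges≡1+k⇒3≤k {suc (suc (suc _))} _ _ = s≤s (s≤s (s≤s z≤n))

4*[1+k]≤2^[1+k] : ∀ {k} → 3 ≤ k → 4 * suc k ≤ 2 ^ suc k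
4*[1+k]≤2^[1+k] 3≤k with t , refl ← m≤n⇒∃[o]m+o≡n 3≤k = 4*[4+t]≤2^[4+t] t
  where
  4*[4+t]≤2^[4+t] : ∀ t → 4 * (4 + t) ≤ 2 ^ (4 + t)
  4*[4+t]≤2^[4+t] zero    = ≤-refl
  4*[4+t]≤2^[4+t] (suc t) = begin
    4 * suc (4 + t)                ≡⟨ *-suc 4 (4 + t) ⟩
    4 + 4 * (4 + t)                ≤⟨ +-monoˡ-≤ (4 * (4 + t)) (m≤m*n 4 (4 + t)) ⟩
    4 * (4 + t) + 4 * (4 + t)      ≡⟨ cong (4 * (4 + t) +_) (sym (+-identityʳ _)) ⟩
    2 * (4 * (4 + t))              ≤⟨ *-monoʳ-≤ 2 (4*[4+t]≤2^[4+t] t) ⟩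
    2 * 2 ^ (4 + t)                ∎
    where open ≤-Reasoning

^-distribʳ-* : ∀ a b s → (a * b) ^ s ≡ a ^ s * b ^ s
^-distribʳ-* a b zero    = refl
^-distribʳ-* a b (suc s) = trans (cong (a * b *_) (^-distribʳ-* a b s))
  (solve 4 (λ a b x y → a :* b :* (x :* y) := a :* x :* (b :* y)) refl a b (a ^ s) (b ^ s))
  where open +-*-Solver

length≡suc⇒∃∈ : ∀ {A : Set} {xs : List A} {l} → length xs ≡ suc l → ∃ (_∈ xs)
length≡suc⇒∃∈ {xs = x ∷ _} _ = x , here refl

numContaining-zero : ∀ {k l} n (G0 : Graph k) → numEdges G0 ≡ suc l → numContaining n 0 G0 ≡ 0
numContaining-zero n G0 ℓ≡1+l =
  cong length (filter-none (containsCopy? {n = n} 0 G0) {Matchings.allMatchings (n * 0)}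
                           (All.tabulate (λ {σ} _ → no-copy {σ})))
  where
  no-copy : ∀ {σ} → ¬ ContainsCopy {n = n} 0 G0 σ
  no-copy {σ} copy with _ , _ , adjacent ← Any.satisfied {P = IsCopy {n = n} 0 G0 σ} copy
                   with _ , e∈ ← length≡suc⇒∃∈ ℓ≡1+l
                   with p , _ ← adjacent _ _ (proj₂ (∈-edgePairs⁻ G0 e∈)) = ¬Fin0 (subst Fin (*-zeroʳ n) p)

module _ {k : ℕ} (G0 : Graph k) (n d : ℕ) .{{_ : NonZero n}} .{{_ : NonZero d}} (ℓ≡1+k : numEdges G0 ≡ suc k) where

  numContaining*n≤-small-nd : ¬ (4 * suc k ≤ 2 + n * d) → numContaining n d G0 * n ≤ (2 * d) ^ suc k * numMatchings n d
  numContaining*n≤-small-nd few-points = begin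
    numContaining n d G0 * n             ≤⟨ *-mono-≤ numContaining≤numMatchings n≤[2d]^[1+k] ⟩
    numMatchings n d * (2 * d) ^ suc k   ≡⟨ *-comm (numMatchings n d) _ ⟩
    (2 * d) ^ suc k * numMatchings n d   ∎
    where
    open ≤-Reasoning
    numContaining≤numMatchings : numContaining n d G0 ≤ numMatchings n d
    numContaining≤numMatchings = length-filter (containsCopy? {n = n} d G0) (matchings n d)

    n≤[2d]^[1+k] : n ≤ (2 * d) ^ suc k
    n≤[2d]^[1+k] = begin
      n           ≤⟨ m≤m*n n d ⟩
      n * d       ≤⟨ m+n≤o⇒n≤o 3 (≰⇒> few-points) ⟩
      4 * suc k   ≤⟨ 4*[1+k]≤2^[1+k] (numEdges≡1+k⇒3≤k G0 ℓ≡1+k) ⟩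
      2 ^ suc k   ≤⟨ ^-monoˡ-≤ (suc k) (m≤m*n 2 d) ⟩
      (2 * d) ^ suc k ∎

  numContaining*n≤-large-nd : 4 * suc k ≤ 2 + n * d → numContaining n d G0 * n ≤ (2 * d) ^ suc k * numMatchings n d
  numContaining*n≤-large-nd many-points = *-cancelˡ-≤ X {{X≢0}} (begin
    X * (C * n)                            ≡⟨ lhs ⟩
    C * (n * d) ^ s                        ≤⟨ numContaining-bound G0 n d ℓ≡1+k many-points ⟩
    n ^ k * (d ^ s * d ^ s) * (2 ^ s * M)  ≡⟨ rhs ⟩
    X * ((2 * d) ^ s * M)                  ∎)
    where
    open ≤-Reasoning
    open +-*-Solver
    s = suc k
    C = numContaining n d G0
    M = numMatchings n d
    X = n ^ k * d ^ s

    X≢0 : NonZero X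
    X≢0 = m*n≢0 (n ^ k) (d ^ s) {{m^n≢0 n k}} {{m^n≢0 d s}}

    lhs : X * (C * n) ≡ C * (n * d) ^ s
    lhs rewrite ^-distribʳ-* n d s =
      solve 4 (λ c n x y → x :* y :* (c :* n) := c :* (n :* x :* y)) refl C n (n ^ k) (d ^ s)

    rhs : n ^ k * (d ^ s * d ^ s) * (2 ^ s * M) ≡ X * ((2 * d) ^ s * M)
    rhs rewrite ^-distribʳ-* 2 d s =
      solve 4 (λ x y t m → x :* (y :* y) :* (t :* m) := x :* y :* (t :* y :* m)) refl (n ^ k) (d ^ s) (2 ^ s) M

proposition4p4 : (k : ℕ) (G0 : Graph k) → numEdges G0 ≡ suc k →
    (n d : ℕ) → d < n → 2 ∣ n * d →
    numContaining n d G0 * n ≤ (2 * d) ^ suc k * numMatchings n d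
proposition4p4 k G0 ℓ≡1+k zero        (suc d)     () _
proposition4p4 k G0 ℓ≡1+k n           zero        _  _ rewrite numContaining-zero n G0 ℓ≡1+k = z≤n
proposition4p4 k G0 ℓ≡1+k n@(suc _) d@(suc _) _  _ with 4 * suc k ≤? 2 + n * d
... | no  few-points  = numContaining*n≤-small-nd G0 n d ℓ≡1+k few-points
... | yes many-points = numContaining*n≤-large-nd G0 n d ℓ≡1+k many-points
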